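{- Let $\lambda\geq3$ be an integer, and let $S\subseteq\{0,1\}^n$ be such that its convex hull satisfies $\mathrm{conv}(S)\supseteq\big[\tfrac1\lambda,1-\tfrac1\lambda\big]^n$. Then $|S|\geq2^{(1-H(1/\lambda))n}$.
   Context: $H$ is the binary entropy function $H(\varepsilon)=-\varepsilon\log_2\varepsilon-(1-\varepsilon)\log_2(1-\varepsilon)$ for $\varepsilon\in(0,\tfrac12]$, $H(0)=0$. -}

module Defs where

open import Data.Nat using (ℕ; zero; suc; _∸_; _^_) renaming (_*_ to _*ℕ_)
open import Data.Bool using (Bool; true; false)
open import Data.Fin using (Fin; zero; suc)
open import Data.Vec using (Vec; lookup)
open import Data.List using (List; length)
import Data.List as List
open import Data.Integer using (+_)
open import Data.Rational using (ℚ; 0ℚ; 1ℚ; _+_; _*_; _-_; _≤_; _/_)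
open import Relation.Binary.PropositionalEquality using (_≡_)

sumFin : (m : ℕ) → (Fin m → ℚ) → ℚ
sumFin zero    f = 0ℚ
sumFin (suc m) f = f zero + sumFin m (λ j → f (suc j))

bitℚ : Bool → ℚ
bitℚ false = 0ℚ
bitℚ true  = 1ℚ

-- 1/λ as a rational (λ = 0 mapped to 0; only used for λ ≥ 3)
recip : ℕ → ℚ
recip zero    = 0ℚ
recip (suc k) = + 1 / suc k

InConvexHull : {n : ℕ} → List (Vec Bool n) → (Fin n → ℚ) → Set
InConvexHull {n} S x =
  Σ' (Fin (length S) → ℚ) λ w →
    ((j : Fin (length S)) → 0ℚ ≤ w j) ×'
    (sumFin (length S) w ≡ 1ℚ) ×'
    ((i : Fin n) → sumFin (length S) (λ j → w j * bitℚ (lookup (List.lookup S j) i)) ≡ x i)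
  where
  open import Data.Product using () renaming (Σ to Σ'; _×_ to _×'_)

InCube : {n : ℕ} → ℕ → (Fin n → ℚ) → Set
InCube {n} λ' x = (i : Fin n) → (recip λ' ≤ x i) ×' (x i ≤ 1ℚ - recip λ')
  where
  open import Data.Product using () renaming (_×_ to _×'_)

-- |S| ≥ 2^{(1 - H(1/λ)) n}, rewritten exactly in ℕ (raise both sides to the λ-th power):
-- 2^{(1-H(1/λ))n} = 2^n (λ-1)^{n(λ-1)/λ} / λ^n, hence the inequality is
-- |S|^λ · λ^{nλ} ≥ 2^{nλ} · (λ-1)^{n(λ-1)}.
EntropyBound : ℕ → ℕ → ℕ → Set
EntropyBound λ' n s = 2 ^ (n *ℕ λ') *ℕ (λ' ∸ 1) ^ (n *ℕ (λ' ∸ 1)) Data.Nat.≤ s ^ λ' *ℕ λ' ^ (n *ℕ λ')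
  where import Data.Nat

{-# OPTIONS --safe #-}
module Submission where

-- Put x_b i = |b_i − 1/λ| for b ∈ {0,1}ⁿ.  This point lies in the cube, hence is a
-- convex combination of S, and since every coordinate of x_b is at distance 1/λ from
-- b_i, the weighted mean Hamming distance from the points of S to b is exactly n/λ.
-- So the Hamming balls of radius ⌊n/λ⌋ around S cover {0,1}ⁿ.  Giving b the weight
-- (λ−1)^(number of coordinates where b agrees with s), every ball has total weight
-- λⁿ, while every b has weight at least (λ−1)^(n − ⌊n/λ⌋) in the ball covering it:
-- |S| λⁿ ≥ 2ⁿ (λ−1)^(n − ⌊n/λ⌋).  Raising to the λ-th power gives the bound.

open import Defs
open import Data.Bool using (Bool; true; false)
open import Data.Fin using (Fin; zero; suc)
open import Data.Vec using (Vec; []; _∷_; lookup)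
open import Data.List using (List; []; _∷_; length; map)
import Data.List as List
open import Data.List.Relation.Unary.Unique.Propositional using (Unique)
open import Data.Nat as ℕ using (ℕ; zero; suc)
open import Data.Product using (∃; _,_; map₂)
open import Data.Rational using (ℚ)
open import Relation.Binary.PropositionalEquality

mismatch : Bool → Bool → ℕ
mismatch false false = 0
mismatch false true  = 1
mismatch true  false = 1
mismatch true  true  = 0

match : Bool → Bool → ℕ
match false false = 1
match false true  = 0
match true  false = 0
match true  true  = 1

hamming : ∀ {n} → Vec Bool n → Vec Bool n → ℕ
hamming []      []      = 0
hamming (a ∷ s) (c ∷ b) = mismatch a c ℕ.+ hamming s b

agreements : ∀ {n} → Vec Bool n → Vec Bool n → ℕ
agreements []      []      = 0
agreements (a ∷ s) (c ∷ b) = match a c ℕ.+ agreements s b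

module ConvexHull where
  open import Data.Empty using (⊥-elim)
  open import Data.Fin.Properties using (any?)
  import Data.Integer as ℤ
  import Data.Integer.Properties as ℤ
  import Data.Nat.Properties as ℕ
  import Data.Nat.Coprimality as Coprime
  open import Data.Rational using (mkℚ; 0ℚ; 1ℚ; _+_; _*_; _-_; -_; _≤_; _<_; _/_; 1/_; nonNegative)
  open import Data.Rational.Properties
  open import Data.Rational.Solver using (module +-*-Solver)
  open import Relation.Nullary using (yes; no)
  open import Algebra.Bundles using (CommutativeRing)
  open CommutativeRing +-*-commutativeRing using (semiring)
  open import Algebra.Properties.Semiring.Mult semiring using (_×_; ×-homo-+; ×1-homo-*; ×-comm-*)
  open import Algebra.Properties.Semiring.Sum semiring
    using (sum; sum-cong-≗; sum-replicate; ∑-comm; *-distribˡ-sum; *-distribʳ-sum)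
  open +-*-Solver

  fromℕ : ℕ → ℚ
  fromℕ n = n × 1ℚ

  fromℕ-nonNeg : ∀ n → 0ℚ ≤ fromℕ n
  fromℕ-nonNeg zero    = ≤-refl
  fromℕ-nonNeg (suc n) = +-mono-≤ (nonNegative⁻¹ 1ℚ) (fromℕ-nonNeg n)

  fromℕ-mono-≤ : ∀ {m n} → m ℕ.≤ n → fromℕ m ≤ fromℕ n
  fromℕ-mono-≤ {n = n} ℕ.z≤n = fromℕ-nonNeg n
  fromℕ-mono-≤ (ℕ.s≤s m≤n)   = +-monoʳ-≤ 1ℚ (fromℕ-mono-≤ m≤n)

  fromℕ<fromℕ-suc : ∀ n → fromℕ n < fromℕ (suc n)
  fromℕ<fromℕ-suc n =
    subst (_< fromℕ (suc n)) (+-identityˡ (fromℕ n)) (+-mono-<-≤ (positive⁻¹ 1ℚ) (≤-refl {fromℕ n}))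

  fromℕ≡mkℚ : ∀ n → fromℕ n ≡ mkℚ (ℤ.+ n) 0 (Coprime.sym (Coprime.1-coprimeTo n))
  fromℕ≡mkℚ zero    = refl
  fromℕ≡mkℚ (suc n) = begin
    1ℚ + fromℕ n                   ≡⟨ cong (1ℚ +_) (fromℕ≡mkℚ n) ⟩
    (ℤ.1ℤ ℤ.+ ℤ.+ n ℤ.* ℤ.1ℤ) / 1  ≡⟨ /-cong (cong (ℤ._+_ ℤ.1ℤ) (ℤ.*-identityʳ (ℤ.+ n))) refl ⟩
    ℤ.+ suc n / 1                  ≡⟨ normalize-coprime (Coprime.sym (Coprime.1-coprimeTo (suc n))) ⟩
    mkℚ (ℤ.+ suc n) 0 _            ∎
    where open ≡-Reasoning

  fromℕ-*-recip : ∀ k → fromℕ (suc k) * recip (suc k) ≡ 1ℚ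
  fromℕ-*-recip k = begin
    fromℕ (suc k) * recip (suc k) ≡⟨ cong₂ _*_ (fromℕ≡mkℚ (suc k)) (normalize-coprime (Coprime.1-coprimeTo (suc k))) ⟩
    p * 1/ p                      ≡⟨ *-inverseʳ p ⟩
    1ℚ                            ∎
    where
    open ≡-Reasoning
    p : ℚ
    p = mkℚ (ℤ.+ suc k) 0 (Coprime.sym (Coprime.1-coprimeTo (suc k)))

  recip-nonNeg : ∀ λ' → 0ℚ ≤ recip λ'
  recip-nonNeg zero    = ≤-refl
  recip-nonNeg (suc k) = nonNegative⁻¹ (recip (suc k)) {{normalize-nonNeg 1 (suc k)}}

  recip≤1-recip : ∀ {λ'} → 2 ℕ.≤ λ' → recip λ' ≤ 1ℚ - recip λ'
  recip≤1-recip {suc k} 2≤λ = begin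
    r                     ≡⟨ solve 1 (λ x → x := (con 1ℚ :+ (con 1ℚ :+ con 0ℚ)) :* x :- x) refl r ⟩
    fromℕ 2 * r - r       ≤⟨ +-monoˡ-≤ (- r) (*-monoʳ-≤-nonNeg r {{nonNegative (recip-nonNeg (suc k))}} (fromℕ-mono-≤ 2≤λ)) ⟩
    fromℕ (suc k) * r - r ≡⟨ cong (_- r) (fromℕ-*-recip k) ⟩
    1ℚ - r                ∎
    where
    open ≤-Reasoning
    r : ℚ
    r = recip (suc k)

  sumFin≡sum : ∀ m (f : Fin m → ℚ) → sumFin m f ≡ sum f
  sumFin≡sum zero    f = refl
  sumFin≡sum (suc m) f = cong (f zero +_) (sumFin≡sum m (λ j → f (suc j)))

  ∑-mono-≤ : ∀ {m} {f g : Fin m → ℚ} → (∀ j → f j ≤ g j) → sum f ≤ sum g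
  ∑-mono-≤ {zero}  f≤g = ≤-refl
  ∑-mono-≤ {suc m} f≤g = +-mono-≤ (f≤g zero) (∑-mono-≤ (λ j → f≤g (suc j)))

  ∑-distrib-- : ∀ {m} (f g : Fin m → ℚ) → sum (λ j → f j - g j) ≡ sum f - sum g
  ∑-distrib-- {zero}  f g = refl
  ∑-distrib-- {suc m} f g = begin
    f zero - g zero + sum (λ j → f (suc j) - g (suc j))
      ≡⟨ cong (f zero - g zero +_) (∑-distrib-- (λ j → f (suc j)) (λ j → g (suc j))) ⟩
    f zero - g zero + (sum (λ j → f (suc j)) - sum (λ j → g (suc j)))
      ≡⟨ solve 4 (λ a b c d → a :- b :+ (c :- d) := a :+ c :- (b :+ d)) refl
           (f zero) (g zero) (sum (λ j → f (suc j))) (sum (λ j → g (suc j))) ⟩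
    f zero + sum (λ j → f (suc j)) - (g zero + sum (λ j → g (suc j))) ∎
    where open ≡-Reasoning

  mean≤⇒∃≤ : ∀ {m} (w : Fin m → ℚ) → (∀ j → 0ℚ ≤ w j) → sum w ≡ 1ℚ →
             (f : Fin m → ℕ) (a : ℕ) → sum (λ j → w j * fromℕ (f j)) ≤ fromℕ a →
             ∃ λ j → f j ℕ.≤ a
  mean≤⇒∃≤ w w≥0 Σw≡1 f a mean≤a with any? (λ j → f j ℕ.≤? a)
  ... | yes found = found
  ... | no none   =
    ⊥-elim (<-irrefl refl (<-≤-trans (fromℕ<fromℕ-suc a) (≤-trans 1+a≤mean mean≤a)))
    where
    open ≤-Reasoning
    1+a≤mean : fromℕ (suc a) ≤ sum (λ j → w j * fromℕ (f j))
    1+a≤mean = begin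
      fromℕ (suc a)                   ≡⟨ sym (*-identityˡ (fromℕ (suc a))) ⟩
      1ℚ * fromℕ (suc a)              ≡⟨ cong (_* fromℕ (suc a)) (sym Σw≡1) ⟩
      sum w * fromℕ (suc a)           ≡⟨ *-distribʳ-sum (fromℕ (suc a)) w ⟩
      sum (λ j → w j * fromℕ (suc a)) ≤⟨ ∑-mono-≤ (λ j →
        *-monoˡ-≤-nonNeg (w j) {{nonNegative (w≥0 j)}} (fromℕ-mono-≤ (ℕ.≰⇒> (λ fj≤a → none (j , fj≤a))))) ⟩
      sum (λ j → w j * fromℕ (f j))   ∎

  distanceToBit : Bool → ℚ → ℚ
  distanceToBit false t = t
  distanceToBit true  t = 1ℚ - t

  distanceToBit-involutive : ∀ c t → distanceToBit c (distanceToBit c t) ≡ t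
  distanceToBit-involutive false t = refl
  distanceToBit-involutive true  t = solve 1 (λ x → con 1ℚ :- (con 1ℚ :- x) := x) refl t

  fromℕ-mismatch : ∀ a c → fromℕ (mismatch a c) ≡ distanceToBit c (bitℚ a)
  fromℕ-mismatch false false = refl
  fromℕ-mismatch false true  = refl
  fromℕ-mismatch true  false = refl
  fromℕ-mismatch true  true  = refl

  ∑-*-distanceToBit : ∀ {m} (w t : Fin m → ℚ) → sum w ≡ 1ℚ → ∀ c →
    sum (λ j → w j * distanceToBit c (t j)) ≡ distanceToBit c (sum (λ j → w j * t j))
  ∑-*-distanceToBit w t Σw≡1 false = refl
  ∑-*-distanceToBit w t Σw≡1 true  = begin
    sum (λ j → w j * (1ℚ - t j))  ≡⟨ sum-cong-≗ (λ j → solve 2 (λ x y → x :* (con 1ℚ :- y) := x :- x :* y) refl (w j) (t j)) ⟩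
    sum (λ j → w j - w j * t j)   ≡⟨ ∑-distrib-- w (λ j → w j * t j) ⟩
    sum w - sum (λ j → w j * t j) ≡⟨ cong (_- sum (λ j → w j * t j)) Σw≡1 ⟩
    1ℚ - sum (λ j → w j * t j)    ∎
    where open ≡-Reasoning

  fromℕ-hamming : ∀ {n} (s b : Vec Bool n) →
    fromℕ (hamming s b) ≡ sum (λ i → fromℕ (mismatch (lookup s i) (lookup b i)))
  fromℕ-hamming []      []      = refl
  fromℕ-hamming (a ∷ s) (c ∷ b) =
    trans (×-homo-+ 1ℚ (mismatch a c) (hamming s b)) (cong (fromℕ (mismatch a c) +_) (fromℕ-hamming s b))

  mean-hamming : ∀ {m n} (w : Fin m → ℚ) → sum w ≡ 1ℚ → (p : Fin m → Vec Bool n) (b : Vec Bool n) →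
    sum (λ j → w j * fromℕ (hamming (p j) b)) ≡
    sum (λ i → distanceToBit (lookup b i) (sum (λ j → w j * bitℚ (lookup (p j) i))))
  mean-hamming w Σw≡1 p b = begin
    sum (λ j → w j * fromℕ (hamming (p j) b))
      ≡⟨ sum-cong-≗ (λ j → cong (w j *_) (fromℕ-hamming (p j) b)) ⟩
    sum (λ j → w j * sum (λ i → fromℕ (mismatch (lookup (p j) i) (lookup b i))))
      ≡⟨ sum-cong-≗ (λ j → *-distribˡ-sum (w j) (λ i → fromℕ (mismatch (lookup (p j) i) (lookup b i)))) ⟩
    sum (λ j → sum (λ i → w j * fromℕ (mismatch (lookup (p j) i) (lookup b i))))
      ≡⟨ ∑-comm (λ j i → w j * fromℕ (mismatch (lookup (p j) i) (lookup b i))) ⟩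
    sum (λ i → sum (λ j → w j * fromℕ (mismatch (lookup (p j) i) (lookup b i))))
      ≡⟨ sum-cong-≗ (λ i → trans (sum-cong-≗ (λ j → cong (w j *_) (fromℕ-mismatch (lookup (p j) i) (lookup b i))))
                                 (∑-*-distanceToBit w (λ j → bitℚ (lookup (p j) i)) Σw≡1 (lookup b i))) ⟩
    sum (λ i → distanceToBit (lookup b i) (sum (λ j → w j * bitℚ (lookup (p j) i)))) ∎
    where open ≡-Reasoning

  nearCorner : ∀ {n} → ℕ → Vec Bool n → Fin n → ℚ
  nearCorner λ' b i = distanceToBit (lookup b i) (recip λ')

  nearCorner-inCube : ∀ {n λ'} → 2 ℕ.≤ λ' → (b : Vec Bool n) → InCube λ' (nearCorner λ' b)
  nearCorner-inCube 2≤λ b i with lookup b i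
  ... | false = ≤-refl , recip≤1-recip 2≤λ
  ... | true  = recip≤1-recip 2≤λ , ≤-refl

  mean-hamming-nearCorner : ∀ {m n} λ' (w : Fin m → ℚ) → sum w ≡ 1ℚ →
    (p : Fin m → Vec Bool n) (b : Vec Bool n) →
    (∀ i → sum (λ j → w j * bitℚ (lookup (p j) i)) ≡ nearCorner λ' b i) →
    sum (λ j → w j * fromℕ (hamming (p j) b)) ≡ n × recip λ'
  mean-hamming-nearCorner {n = n} λ' w Σw≡1 p b combination = begin
    sum (λ j → w j * fromℕ (hamming (p j) b))
      ≡⟨ mean-hamming w Σw≡1 p b ⟩
    sum (λ i → distanceToBit (lookup b i) (sum (λ j → w j * bitℚ (lookup (p j) i))))
      ≡⟨ sum-cong-≗ (λ i → trans (cong (distanceToBit (lookup b i)) (combination i))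
                                 (distanceToBit-involutive (lookup b i) (recip λ'))) ⟩
    sum (λ (_ : Fin n) → recip λ')
      ≡⟨ sum-replicate n {recip λ'} ⟩
    n × recip λ' ∎
    where open ≡-Reasoning

  hull⇒covering : ∀ {n} λ' → 2 ℕ.≤ λ' → (S : List (Vec Bool n)) →
    ((x : Fin n → ℚ) → InCube λ' x → InConvexHull S x) →
    (b : Vec Bool n) → ∃ λ j → λ' ℕ.* hamming (List.lookup S j) b ℕ.≤ n
  hull⇒covering {n} λ'@(suc k) 2≤λ S hull b with hull (nearCorner λ' b) (nearCorner-inCube 2≤λ b)
  ... | w , w≥0 , sumFin-w≡1 , sumFin-combination =
    mean≤⇒∃≤ w w≥0 Σw≡1 (λ j → λ' ℕ.* d j) n (≤-reflexive scaled-mean)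
    where
    open ≡-Reasoning
    Σw≡1 : sum w ≡ 1ℚ
    Σw≡1 = trans (sym (sumFin≡sum (length S) w)) sumFin-w≡1
    combination : ∀ i → sum (λ j → w j * bitℚ (lookup (List.lookup S j) i)) ≡ nearCorner λ' b i
    combination i = trans (sym (sumFin≡sum (length S) _)) (sumFin-combination i)
    d : Fin (length S) → ℕ
    d j = hamming (List.lookup S j) b
    scaled-mean : sum (λ j → w j * fromℕ (λ' ℕ.* d j)) ≡ fromℕ n
    scaled-mean = begin
      sum (λ j → w j * fromℕ (λ' ℕ.* d j))
        ≡⟨ sum-cong-≗ (λ j → trans (cong (w j *_) (×1-homo-* λ' (d j)))
             (solve 3 (λ x y z → x :* (y :* z) := y :* (x :* z)) refl (w j) (fromℕ λ') (fromℕ (d j)))) ⟩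
      sum (λ j → fromℕ λ' * (w j * fromℕ (d j)))
        ≡⟨ sym (*-distribˡ-sum (fromℕ λ') (λ j → w j * fromℕ (d j))) ⟩
      fromℕ λ' * sum (λ j → w j * fromℕ (d j))
        ≡⟨ cong (fromℕ λ' *_) (mean-hamming-nearCorner λ' w Σw≡1 (List.lookup S) b combination) ⟩
      fromℕ λ' * (n × recip λ')
        ≡⟨ ×-comm-* n (fromℕ λ') (recip λ') ⟩
      n × (fromℕ λ' * recip λ')
        ≡⟨ cong (n ×_) (fromℕ-*-recip k) ⟩
      fromℕ n ∎

open ConvexHull using (hull⇒covering)

open import Data.Nat using (_+_; _*_; _∸_; _^_; _/_; NonZero; _≤_; s≤s)
open import Data.Nat.Properties
open import Data.Nat.DivMod using (m*n/n≡m; /-congˡ; /-monoˡ-≤; m/n*n≤m)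
open import Data.Nat.ListAction using (sum)
open import Data.List.Properties using (map-cong)
open import Algebra.Properties.CommutativeSemigroup +-commutativeSemigroup
  using () renaming (interchange to +-interchange)
open import Algebra.Properties.CommutativeSemigroup *-commutativeSemigroup
  using () renaming (interchange to *-interchange)

sumCube : (n : ℕ) → (Vec Bool n → ℕ) → ℕ
sumCube zero    f = f []
sumCube (suc n) f = sumCube n (λ v → f (false ∷ v)) + sumCube n (λ v → f (true ∷ v))

sumCube-mono-≤ : ∀ n {f g : Vec Bool n → ℕ} → (∀ b → f b ≤ g b) → sumCube n f ≤ sumCube n g
sumCube-mono-≤ zero    f≤g = f≤g []
sumCube-mono-≤ (suc n) f≤g =
  +-mono-≤ (sumCube-mono-≤ n (λ v → f≤g (false ∷ v))) (sumCube-mono-≤ n (λ v → f≤g (true ∷ v)))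

sumCube-const : ∀ n c → sumCube n (λ _ → c) ≡ 2 ^ n * c
sumCube-const zero    c = sym (+-identityʳ c)
sumCube-const (suc n) c = begin
  sumCube n (λ _ → c) + sumCube n (λ _ → c) ≡⟨ cong₂ _+_ (sumCube-const n c) (sumCube-const n c) ⟩
  2 ^ n * c + 2 ^ n * c                     ≡⟨ cong (2 ^ n * c +_) (sym (+-identityʳ (2 ^ n * c))) ⟩
  2 * (2 ^ n * c)                           ≡⟨ sym (*-assoc 2 (2 ^ n) c) ⟩
  2 ^ suc n * c                             ∎
  where open ≡-Reasoning

sumCube-distrib-+ : ∀ n (f g : Vec Bool n → ℕ) →
  sumCube n (λ b → f b + g b) ≡ sumCube n f + sumCube n g
sumCube-distrib-+ zero    f g = refl
sumCube-distrib-+ (suc n) f g = begin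
  sumCube n (λ v → f (false ∷ v) + g (false ∷ v)) + sumCube n (λ v → f (true ∷ v) + g (true ∷ v))
    ≡⟨ cong₂ _+_ (sumCube-distrib-+ n _ _) (sumCube-distrib-+ n _ _) ⟩
  (sumCube n (λ v → f (false ∷ v)) + sumCube n (λ v → g (false ∷ v))) +
  (sumCube n (λ v → f (true ∷ v))  + sumCube n (λ v → g (true ∷ v)))
    ≡⟨ +-interchange (sumCube n (λ v → f (false ∷ v))) (sumCube n (λ v → g (false ∷ v)))
                     (sumCube n (λ v → f (true ∷ v))) (sumCube n (λ v → g (true ∷ v))) ⟩
  sumCube (suc n) f + sumCube (suc n) g ∎
  where open ≡-Reasoning

sumCube-*ˡ : ∀ n c (f : Vec Bool n → ℕ) → sumCube n (λ b → c * f b) ≡ c * sumCube n f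
sumCube-*ˡ zero    c f = refl
sumCube-*ˡ (suc n) c f = begin
  sumCube n (λ v → c * f (false ∷ v)) + sumCube n (λ v → c * f (true ∷ v))
    ≡⟨ cong₂ _+_ (sumCube-*ˡ n c _) (sumCube-*ˡ n c _) ⟩
  c * sumCube n (λ v → f (false ∷ v)) + c * sumCube n (λ v → f (true ∷ v))
    ≡⟨ sym (*-distribˡ-+ c _ _) ⟩
  c * sumCube (suc n) f ∎
  where open ≡-Reasoning

sumCube-pow-agreements : ∀ n x (s : Vec Bool n) → sumCube n (λ b → x ^ agreements s b) ≡ suc x ^ n
sumCube-pow-agreements zero    x []      = refl
sumCube-pow-agreements (suc n) x (false ∷ s) = begin
  sumCube n (λ v → x * x ^ agreements s v) + sumCube n (λ v → x ^ agreements s v)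
    ≡⟨ cong₂ _+_ (trans (sumCube-*ˡ n x _) (cong (x *_) ih)) ih ⟩
  x * suc x ^ n + suc x ^ n
    ≡⟨ +-comm (x * suc x ^ n) (suc x ^ n) ⟩
  suc x ^ suc n ∎
  where
  open ≡-Reasoning
  ih : sumCube n (λ b → x ^ agreements s b) ≡ suc x ^ n
  ih = sumCube-pow-agreements n x s
sumCube-pow-agreements (suc n) x (true ∷ s) = begin
  sumCube n (λ v → x ^ agreements s v) + sumCube n (λ v → x * x ^ agreements s v)
    ≡⟨ cong₂ _+_ ih (trans (sumCube-*ˡ n x _) (cong (x *_) ih)) ⟩
  suc x ^ suc n ∎
  where
  open ≡-Reasoning
  ih : sumCube n (λ b → x ^ agreements s b) ≡ suc x ^ n
  ih = sumCube-pow-agreements n x s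

lookup≤sum-map : ∀ {A : Set} (S : List A) (f : A → ℕ) j → f (List.lookup S j) ≤ sum (map f S)
lookup≤sum-map (s ∷ S) f zero    = m≤m+n (f s) (sum (map f S))
lookup≤sum-map (s ∷ S) f (suc j) = ≤-trans (lookup≤sum-map S f j) (m≤n+m (sum (map f S)) (f s))

sum-map-const : ∀ {A : Set} (S : List A) c → sum (map (λ _ → c) S) ≡ length S * c
sum-map-const []      c = refl
sum-map-const (s ∷ S) c = cong (c +_) (sum-map-const S c)

sumCube-sum-map-comm : ∀ n {A : Set} (S : List A) (f : A → Vec Bool n → ℕ) →
  sumCube n (λ b → sum (map (λ s → f s b) S)) ≡ sum (map (λ s → sumCube n (f s)) S)
sumCube-sum-map-comm n []      f = trans (sumCube-const n 0) (*-zeroʳ (2 ^ n))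
sumCube-sum-map-comm n (s ∷ S) f =
  trans (sumCube-distrib-+ n (f s) (λ b → sum (map (λ s → f s b) S)))
        (cong (sumCube n (f s) +_) (sumCube-sum-map-comm n S f))

hamming+agreements≡n : ∀ {n} (s b : Vec Bool n) → hamming s b + agreements s b ≡ n
hamming+agreements≡n []      []      = refl
hamming+agreements≡n (false ∷ s) (false ∷ b) =
  trans (+-suc (hamming s b) (agreements s b)) (cong suc (hamming+agreements≡n s b))
hamming+agreements≡n (false ∷ s) (true  ∷ b) = cong suc (hamming+agreements≡n s b)
hamming+agreements≡n (true  ∷ s) (false ∷ b) = cong suc (hamming+agreements≡n s b)
hamming+agreements≡n (true  ∷ s) (true  ∷ b) =
  trans (+-suc (hamming s b) (agreements s b)) (cong suc (hamming+agreements≡n s b))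

hamming≤⇒∸≤agreements : ∀ {n} q (s b : Vec Bool n) → hamming s b ≤ q → n ∸ q ≤ agreements s b
hamming≤⇒∸≤agreements {n} q s b d≤q = begin
  n ∸ q                                       ≤⟨ ∸-monoʳ-≤ n d≤q ⟩
  n ∸ hamming s b                             ≡⟨ cong (_∸ hamming s b) (sym (hamming+agreements≡n s b)) ⟩
  hamming s b + agreements s b ∸ hamming s b  ≡⟨ m+n∸m≡n (hamming s b) (agreements s b) ⟩
  agreements s b                              ∎
  where open ≤-Reasoning

covering⇒size-bound : ∀ x .{{_ : NonZero x}} {n} q (S : List (Vec Bool n)) →
  (∀ b → ∃ λ j → hamming (List.lookup S j) b ≤ q) →
  2 ^ n * x ^ (n ∸ q) ≤ length S * suc x ^ n
covering⇒size-bound x {n} q S covered = begin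
  2 ^ n * x ^ (n ∸ q)                                       ≡⟨ sym (sumCube-const n _) ⟩
  sumCube n (λ _ → x ^ (n ∸ q))                             ≤⟨ sumCube-mono-≤ n covered-weight ⟩
  sumCube n (λ b → sum (map (λ s → x ^ agreements s b) S))  ≡⟨ sumCube-sum-map-comm n S _ ⟩
  sum (map (λ s → sumCube n (λ b → x ^ agreements s b)) S)  ≡⟨ cong sum (map-cong (sumCube-pow-agreements n x) S) ⟩
  sum (map (λ _ → suc x ^ n) S)                             ≡⟨ sum-map-const S _ ⟩
  length S * suc x ^ n                                      ∎
  where
  open ≤-Reasoning
  covered-weight : ∀ b → x ^ (n ∸ q) ≤ sum (map (λ s → x ^ agreements s b) S)
  covered-weight b with covered b
  ... | j , d≤q = ≤-trans (^-monoʳ-≤ x (hamming≤⇒∸≤agreements q (List.lookup S j) b d≤q))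
                          (lookup≤sum-map S (λ s → x ^ agreements s b) j)

m*n≤o⇒n≤o/m : ∀ m .{{_ : NonZero m}} {n o} → m * n ≤ o → n ≤ o / m
m*n≤o⇒n≤o/m m {n} {o} mn≤o = begin
  n          ≡⟨ sym (m*n/n≡m n m) ⟩
  n * m / m  ≡⟨ /-congˡ (*-comm n m) ⟩
  m * n / m  ≤⟨ /-monoˡ-≤ m mn≤o ⟩
  o / m      ∎
  where open ≤-Reasoning

m*n≤[m∸m/[1+n]]*[1+n] : ∀ m n → m * n ≤ (m ∸ m / suc n) * suc n
m*n≤[m∸m/[1+n]]*[1+n] m n = begin
  m * n                           ≡⟨ sym (m+n∸m≡n m (m * n)) ⟩
  m + m * n ∸ m                   ≡⟨ cong (_∸ m) (sym (*-suc m n)) ⟩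
  m * suc n ∸ m                   ≤⟨ ∸-monoʳ-≤ (m * suc n) (m/n*n≤m m (suc n)) ⟩
  m * suc n ∸ m / suc n * suc n   ≡⟨ sym (*-distribʳ-∸ (suc n) m (m / suc n)) ⟩
  (m ∸ m / suc n) * suc n         ∎
  where open ≤-Reasoning

^-distribʳ-* : ∀ m n o → (m * n) ^ o ≡ m ^ o * n ^ o
^-distribʳ-* m n zero    = refl
^-distribʳ-* m n (suc o) = trans (cong (m * n *_) (^-distribʳ-* m n o)) (*-interchange m n (m ^ o) (n ^ o))

theorem2p3 : (λ' n : ℕ) → 3 ≤ λ' → (S : List (Vec Bool n)) → Unique S →
    ((x : Fin n → ℚ) → InCube λ' x → InConvexHull S x) →
    EntropyBound λ' n (length S)
theorem2p3 zero       _ ()       _ _ _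
theorem2p3 (suc zero) _ (s≤s ()) _ _ _
-- Duplicates in S only make length S larger.
theorem2p3 λ'@(suc k@(suc _)) n 3≤λ S _ hull = begin
  2 ^ (n * λ') * k ^ (n * k)         ≤⟨ *-monoʳ-≤ (2 ^ (n * λ')) (^-monoʳ-≤ k (m*n≤[m∸m/[1+n]]*[1+n] n k)) ⟩
  2 ^ (n * λ') * k ^ ((n ∸ q) * λ')  ≡⟨ sym (cong₂ _*_ (^-*-assoc 2 n λ') (^-*-assoc k (n ∸ q) λ')) ⟩
  (2 ^ n) ^ λ' * (k ^ (n ∸ q)) ^ λ'  ≡⟨ sym (^-distribʳ-* (2 ^ n) (k ^ (n ∸ q)) λ') ⟩
  (2 ^ n * k ^ (n ∸ q)) ^ λ'         ≤⟨ ^-monoˡ-≤ λ' (covering⇒size-bound k q S covered) ⟩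
  (length S * λ' ^ n) ^ λ'           ≡⟨ ^-distribʳ-* (length S) (λ' ^ n) λ' ⟩
  length S ^ λ' * (λ' ^ n) ^ λ'      ≡⟨ cong (length S ^ λ' *_) (^-*-assoc λ' n λ') ⟩
  length S ^ λ' * λ' ^ (n * λ')      ∎
  where
  open ≤-Reasoning
  q : ℕ
  q = n / λ'
  covered : ∀ b → ∃ λ j → hamming (List.lookup S j) b ≤ q
  covered b = map₂ (m*n≤o⇒n≤o/m λ') (hull⇒covering λ' (≤-trans (n≤1+n 2) 3≤λ) S hull b)
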